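{- For all positive integers $r,s,n$ with $s\le r$ we have $F_{r,s}(n)\le G_{r,s}(n)\le n^{r-s+1}$. Moreover, whenever $n$ is a perfect $s$th power, $G_{r,s}(n)\ge F_{r,s}(n)\ge n^{r/s}$.
   Context: $[n]=\{1,\dots,n\}$. An $r$-tuple $a=(a_1,\dots,a_r)$ of integers is $s$-less than an $r$-tuple $b=(b_1,\dots,b_r)$, written $a<_sb$, if $a_i<b_i$ for at least $s$ indices $i$. A sequence $a^1,\dots,a^m$ of $r$-tuples is $s$-increasing if $a^i<_sa^j$ whenever $i<j$. Two $r$-tuples are $s$-comparable if one is $s$-less than the other, and a set of $r$-tuples is $s$-comparable if any two distinct elements are $s$-comparable. $F_{r,s}(n)$ is the greatest length of an $s$-increasing sequence of $r$-tuples with entries in $[n]$, and $G_{r,s}(n)$ is the greatest size of an $s$-comparable set of $r$-tuples with entries in $[n]$. -}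

module Defs where

open import Data.Nat using (ℕ; _≤_; _<_; _<?_)
open import Data.Fin using (Fin) renaming (_<_ to _<ᶠ_)
open import Data.List using (length; filter; allFin)
open import Data.Vec using (Vec; lookup)
open import Data.Product using (Σ; _×_)
open import Data.Sum using (_⊎_)
open import Relation.Binary.PropositionalEquality using (_≡_; _≢_)
open import Function.Definitions using (Injective)

Tuple : ℕ → Set
Tuple r = Vec ℕ r

InRange : ∀ {r} → ℕ → Tuple r → Set
InRange n a = ∀ i → 1 ≤ lookup a i × lookup a i ≤ n

countLess : ∀ {r} → Tuple r → Tuple r → ℕ
countLess {r} a b = length (filter (λ i → lookup a i <? lookup b i) (allFin r))

_<[_]_ : ∀ {r} → Tuple r → ℕ → Tuple r → Set
a <[ s ] b = s ≤ countLess a b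

SIncreasing : ∀ {r m} → ℕ → (Fin m → Tuple r) → Set
SIncreasing {m = m} s a = ∀ (i j : Fin m) → i <ᶠ j → a i <[ s ] a j

SComparable : ∀ {r} → ℕ → Tuple r → Tuple r → Set
SComparable s a b = a <[ s ] b ⊎ b <[ s ] a

SComparableSet : ∀ {r m} → ℕ → (Fin m → Tuple r) → Set
SComparableSet {m = m} s a = ∀ (i j : Fin m) → a i ≢ a j → SComparable s (a i) (a j)

HasIncSeq : ℕ → ℕ → ℕ → ℕ → Set
HasIncSeq r s n m = Σ (Fin m → Tuple r) λ a → (∀ i → InRange n (a i)) × SIncreasing s a

HasCompSet : ℕ → ℕ → ℕ → ℕ → Set
HasCompSet r s n m = Σ (Fin m → Tuple r) λ a →
  Injective _≡_ _≡_ a × (∀ i → InRange n (a i)) × SComparableSet s a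

IsF : ℕ → ℕ → ℕ → ℕ → Set
IsF r s n F = HasIncSeq r s n F × (∀ m → HasIncSeq r s n m → m ≤ F)

IsG : ℕ → ℕ → ℕ → ℕ → Set
IsG r s n G = HasCompSet r s n G × (∀ m → HasCompSet r s n m → m ≤ G)

-- Upper bound: if two tuples agree in their first r − s + 1 coordinates they differ in at
-- most s − 1 places, so neither is s-less than the other. Hence truncation to those
-- coordinates is injective on an s-comparable set, which therefore has at most
-- n ^ (r − s + 1) elements; an s-increasing sequence is an s-comparable set.
--
-- Lower bound for n = k ^ s: write each N < k ^ r with r base-k digits, and let
-- coordinate j of the N-th tuple be 1 + the base-k number formed by the s digits of N in
-- a cyclic window of positions attached to j. If N < M first differ at digit p, then p
-- lies in exactly s of the windows, and in each of those coordinates the N-th tuple is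
-- the smaller one.
--
-- F and G exist because both properties are decidable (entries range over a finite set)
-- and bounded by the upper bound.
module Submission where

open import Defs
open import Data.Nat using (ℕ; _≤_; _∸_; _+_; _^_)
open import Data.Product using (Σ; _×_)
open import Relation.Binary.PropositionalEquality using (_≡_)

open import Data.Nat
  using (zero; suc; _*_; _<_; _<?_; _≤?_; _⊓_; z≤n; s≤s; s≤s⁻¹; NonZero; >-nonZero)
open import Data.Nat.Properties
open import Data.Nat.DivMod using (_/_; _%_; [m+n]%n≡m%n; m<n⇒m%n≡m; m%n<n; m<n*o⇒m/o<n; /-monoˡ-≤; m≡m%n+[m/n]*n)
open import Data.Bool using (Bool; true; false; if_then_else_)
open import Data.Fin using (Fin; toℕ) renaming (zero to fzero; suc to fsuc; _<?_ to _<ᶠ?_; _≟_ to _≟ᶠ_)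
open import Data.Fin.Properties using (toℕ<n; all?; injective⇒≤) renaming (<-cmp to <ᶠ-cmp)
open import Data.Vec using (Vec; []; _∷_; lookup; tabulate; truncate)
open import Data.Vec.Properties using (lookup∘tabulate; ∷-injectiveˡ; ∷-injectiveʳ; ≡-dec)
import Data.Vec.Functional as Vector
open import Data.List using (List; length; filter; map; _++_; cartesianProductWith; applyUpTo)
  renaming ([] to []ˡ; _∷_ to _∷ˡ_; tabulate to tabulateˡ)
open import Data.List.Properties using (length-++; length-map; length-applyUpTo)
open import Data.List.Relation.Unary.All using (All) renaming ([] to []ᵃ; _∷_ to _∷ᵃ_)
open import Data.List.Relation.Unary.Any using (Any; here; any?; satisfied; index)
open import Data.List.Membership.Propositional using (_∈_; lose)
open import Data.List.Membership.Propositional.Properties using (∈-cartesianProductWith⁺; ∈-applyUpTo⁺)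
open import Data.List.Membership.Setoid.Properties using (index-injective)
open import Data.Product using (∃; _,_)
open import Data.Sum using (_⊎_; inj₁; inj₂)
import Data.Sum as Sum
open import Function using (_∘_; id)
open import Function.Definitions using (Injective)
open import Relation.Binary.Definitions using (DecidableEquality; tri<; tri≈; tri>)
open import Relation.Binary.PropositionalEquality
  using (_≢_; refl; sym; trans; cong; cong₂; subst; subst₂; setoid; module ≡-Reasoning)
open import Relation.Nullary using (Dec; yes; no; does; ¬_; contradiction)
open import Relation.Nullary.Decidable using (map′; _×-dec_; _⊎-dec_; _→-dec_; ¬?; dec-true; dec-false)
open import Relation.Unary using (Pred; Decidable)

private
  variable
    A : Set
    r s t n m k : ℕ

bit : Bool → ℕ
bit false = 0
bit true  = 1

count : ∀ r → (Fin r → Bool) → ℕ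
count zero    b = 0
count (suc r) b = bit (b fzero) + count r (b ∘ fsuc)

length-filter-tabulate : ∀ {P : A → Set} (P? : Decidable P) (f : Fin r → A) →
  length (filter P? (tabulateˡ f)) ≡ count r (λ i → does (P? (f i)))
length-filter-tabulate {r = zero}  P? f = refl
length-filter-tabulate {r = suc r} P? f with does (P? (f fzero))
... | true  = cong suc (length-filter-tabulate P? (f ∘ fsuc))
... | false = length-filter-tabulate P? (f ∘ fsuc)

countLess≡count : (a b : Tuple r) → countLess a b ≡ count r (λ i → does (lookup a i <? lookup b i))
countLess≡count a b = length-filter-tabulate (λ i → lookup a i <? lookup b i) id

count-cong : ∀ r {b c : Fin r → Bool} → (∀ i → b i ≡ c i) → count r b ≡ count r c
count-cong zero    b≗c = refl
count-cong (suc r) b≗c = cong₂ (λ x y → bit x + y) (b≗c fzero) (count-cong r (b≗c ∘ fsuc))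

count-mono : ∀ r {b c : Fin r → Bool} → (∀ i → b i ≡ true → c i ≡ true) → count r b ≤ count r c
count-mono zero    b⊆c = z≤n
count-mono (suc r) {b} {c} b⊆c with b fzero | c fzero | b⊆c fzero
... | false | false | _ = count-mono r (b⊆c ∘ fsuc)
... | false | true  | _ = m≤n⇒m≤1+n (count-mono r (b⊆c ∘ fsuc))
... | true  | true  | _ = s≤s (count-mono r (b⊆c ∘ fsuc))
... | true  | false | h with () ← h refl

count≤ : ∀ r (b : Fin r → Bool) → count r b ≤ r
count≤ zero    b = z≤n
count≤ (suc r) b with b fzero
... | true  = s≤s (count≤ r (b ∘ fsuc))
... | false = m≤n⇒m≤1+n (count≤ r (b ∘ fsuc))

count≤∸ : ∀ r t {b : Fin r → Bool} → (∀ i → toℕ i < t → b i ≡ false) → count r b ≤ r ∸ t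
count≤∸ zero    t           below = z≤n
count≤∸ (suc r) zero    {b} below = count≤ (suc r) b
count≤∸ (suc r) (suc t)     below
  rewrite below fzero (s≤s z≤n) = count≤∸ r t (λ i i<t → below (fsuc i) (s≤s i<t))

count-false : ∀ r → count r (λ _ → false) ≡ 0
count-false zero    = refl
count-false (suc r) = count-false r

count-< : ∀ r s → count r (λ i → does (toℕ i <? s)) ≡ r ⊓ s
count-< zero    s       = refl
count-< (suc r) zero    = count-false r
count-< (suc r) (suc s) = cong suc (count-< r s)

count-snoc : ∀ r (B : ℕ → Bool) → count (suc r) (B ∘ toℕ) ≡ count r (B ∘ toℕ) + bit (B r)
count-snoc zero    B = +-identityʳ (bit (B 0))
count-snoc (suc r) B = begin
  bit (B 0) + count (suc r) (B ∘ suc ∘ toℕ)              ≡⟨ cong (bit (B 0) +_) (count-snoc r (B ∘ suc)) ⟩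
  bit (B 0) + (count r (B ∘ suc ∘ toℕ) + bit (B (suc r))) ≡⟨ +-assoc (bit (B 0)) _ _ ⟨
  count (suc r) (B ∘ toℕ) + bit (B (suc r))              ∎
  where open ≡-Reasoning

count-rotate : ∀ r (B : ℕ → Bool) → B r ≡ B 0 → count r (B ∘ suc ∘ toℕ) ≡ count r (B ∘ toℕ)
count-rotate r B Br≡B0 = +-cancelˡ-≡ (bit (B 0)) _ _ (begin
  bit (B 0) + count r (B ∘ suc ∘ toℕ)  ≡⟨ count-snoc r B ⟩
  count r (B ∘ toℕ) + bit (B r)        ≡⟨ cong (λ x → count r (B ∘ toℕ) + bit x) Br≡B0 ⟩
  count r (B ∘ toℕ) + bit (B 0)        ≡⟨ +-comm _ (bit (B 0)) ⟩
  bit (B 0) + count r (B ∘ toℕ)        ∎)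
  where open ≡-Reasoning

count-shift : ∀ r p (B : ℕ → Bool) → (∀ x → B (x + r) ≡ B x) →
  count r (λ i → B (p + toℕ i)) ≡ count r (B ∘ toℕ)
count-shift r zero    B periodic = refl
count-shift r (suc p) B periodic =
  trans (count-shift r p (B ∘ suc) (periodic ∘ suc)) (count-rotate r B (periodic 0))

count-window : ∀ r .{{_ : NonZero r}} {s} → s ≤ r → ∀ p → count r (λ i → does ((p + toℕ i) % r <? s)) ≡ s
count-window r {s} s≤r p = begin
  count r (λ i → B (p + toℕ i))      ≡⟨ count-shift r p B (λ x → cong (λ y → does (y <? s)) ([m+n]%n≡m%n x r)) ⟩
  count r (B ∘ toℕ)                  ≡⟨ count-cong r (λ i → cong (λ y → does (y <? s)) (m<n⇒m%n≡m (toℕ<n i))) ⟩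
  count r (λ i → does (toℕ i <? s))  ≡⟨ count-< r s ⟩
  r ⊓ s                              ≡⟨ m≥n⇒m⊓n≡n s≤r ⟩
  s                                  ∎
  where
  open ≡-Reasoning
  B : ℕ → Bool
  B x = does (x % r <? s)

countLess-agree : (a b : Tuple r) → (∀ i → toℕ i < t → lookup a i ≡ lookup b i) → countLess a b ≤ r ∸ t
countLess-agree {r} {t} a b agree = ≤-trans (≤-reflexive (countLess≡count a b))
  (count≤∸ r t (λ i i<t → dec-false (lookup a i <? lookup b i) (<-irrefl (agree i i<t))))

<[s]-irrefl : 1 ≤ s → (a : Tuple r) → ¬ (a <[ s ] a)
<[s]-irrefl {s} {r} 1≤s a a<a = <⇒≱ 1≤s (begin
  s               ≤⟨ a<a ⟩
  countLess a a   ≤⟨ countLess-agree {t = r} a a (λ _ _ → refl) ⟩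
  r ∸ r           ≡⟨ n∸n≡0 r ⟩
  0               ∎)
  where open ≤-Reasoning

truncate-agree : (t≤r : t ≤ r) (a b : Vec A r) → truncate t≤r a ≡ truncate t≤r b →
  ∀ i → toℕ i < t → lookup a i ≡ lookup b i
truncate-agree (s≤s t≤r) (x ∷ a) (y ∷ b) eq fzero    _         = ∷-injectiveˡ eq
truncate-agree (s≤s t≤r) (x ∷ a) (y ∷ b) eq (fsuc i) (s≤s i<t) = truncate-agree t≤r a b (∷-injectiveʳ eq) i i<t

InRange-truncate : (t≤r : t ≤ r) {a : Tuple r} → InRange n a → InRange n (truncate t≤r a)
InRange-truncate (s≤s t≤r) {x ∷ a} inRange fzero    = inRange fzero
InRange-truncate (s≤s t≤r) {x ∷ a} inRange (fsuc i) = InRange-truncate t≤r (inRange ∘ fsuc) i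

width≤ : 1 ≤ s → s ≤ r → r ∸ s + 1 ≤ r
width≤ {s} {r} 1≤s s≤r = ≤-trans (+-monoʳ-≤ (r ∸ s) 1≤s) (≤-reflexive (m∸n+n≡m s≤r))

<[s]⇒truncate≢ : (1≤s : 1 ≤ s) (s≤r : s ≤ r) {a b : Tuple r} → a <[ s ] b →
  truncate (width≤ 1≤s s≤r) a ≢ truncate (width≤ 1≤s s≤r) b
<[s]⇒truncate≢ {s} {r} 1≤s s≤r {a} {b} a<b eq = <⇒≱ s∸1<s (begin
  s                        ≤⟨ a<b ⟩
  countLess a b            ≤⟨ countLess-agree a b (truncate-agree (width≤ 1≤s s≤r) a b eq) ⟩
  r ∸ (r ∸ s + 1)          ≡⟨ ∸-+-assoc r (r ∸ s) 1 ⟨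
  r ∸ (r ∸ s) ∸ 1          ≡⟨ cong (_∸ 1) (m∸[m∸n]≡n s≤r) ⟩
  s ∸ 1                    ∎)
  where
  open ≤-Reasoning
  s∸1<s : s ∸ 1 < s
  s∸1<s = ∸-monoʳ-< (s≤s z≤n) 1≤s

tuples : ℕ → ∀ t → List (Tuple t)
tuples n zero    = [] ∷ˡ []ˡ
tuples n (suc t) = cartesianProductWith _∷_ (applyUpTo suc n) (tuples n t)

∈-tuples : {a : Tuple t} → InRange n a → a ∈ tuples n t
∈-tuples {a = []}    _       = here refl
∈-tuples {a = x ∷ a} inRange =
  ∈-cartesianProductWith⁺ _∷_ (∈-upTo-suc (inRange fzero)) (∈-tuples (inRange ∘ fsuc))
  where
  ∈-upTo-suc : ∀ {x} → 1 ≤ x × x ≤ n → x ∈ applyUpTo suc n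
  ∈-upTo-suc (s≤s z≤n , x≤n) = ∈-applyUpTo⁺ suc x≤n

length-cartesianProductWith : ∀ {B C : Set} (f : A → B → C) xs ys →
  length (cartesianProductWith f xs ys) ≡ length xs * length ys
length-cartesianProductWith f []ˡ       ys = refl
length-cartesianProductWith f (x ∷ˡ xs) ys = begin
  length (map (f x) ys ++ cartesianProductWith f xs ys)          ≡⟨ length-++ (map (f x) ys) ⟩
  length (map (f x) ys) + length (cartesianProductWith f xs ys)  ≡⟨ cong₂ _+_ (length-map (f x) ys) (length-cartesianProductWith f xs ys) ⟩
  length ys + length xs * length ys                              ∎
  where open ≡-Reasoning

length-tuples : ∀ n t → length (tuples n t) ≡ n ^ t
length-tuples n zero    = refl
length-tuples n (suc t) = trans (length-cartesianProductWith _∷_ (applyUpTo suc n) (tuples n t))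
                                (cong₂ _*_ (length-applyUpTo suc n) (length-tuples n t))

injective-∈⇒≤ : {f : Fin m → A} {xs : List A} → Injective _≡_ _≡_ f → (∀ i → f i ∈ xs) → m ≤ length xs
injective-∈⇒≤ {f = f} inj f∈xs =
  injective⇒≤ {f = index ∘ f∈xs} (inj ∘ index-injective (setoid _) (f∈xs _) (f∈xs _))

compSet-bound : 1 ≤ s → s ≤ r → HasCompSet r s n m → m ≤ n ^ (r ∸ s + 1)
compSet-bound {s} {r} {n} 1≤s s≤r (a , inj , inRange , comparable) =
  subst (_ ≤_) (length-tuples n (r ∸ s + 1))
    (injective-∈⇒≤ {f = truncate′ ∘ a} truncate-inj (λ i → ∈-tuples (InRange-truncate _ (inRange i))))
  where
  truncate′ : Tuple r → Tuple (r ∸ s + 1)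
  truncate′ = truncate (width≤ 1≤s s≤r)
  truncate-inj : Injective _≡_ _≡_ (truncate′ ∘ a)
  truncate-inj {i} {j} eq with ≡-dec _≟_ (a i) (a j)
  ... | yes ai≡aj = inj ai≡aj
  ... | no ai≢aj with comparable i j ai≢aj
  ...   | inj₁ ai<aj = contradiction eq (<[s]⇒truncate≢ 1≤s s≤r ai<aj)
  ...   | inj₂ aj<ai = contradiction (sym eq) (<[s]⇒truncate≢ 1≤s s≤r aj<ai)

incSeq⇒compSet : 1 ≤ s → HasIncSeq r s n m → HasCompSet r s n m
incSeq⇒compSet {s} 1≤s (a , inRange , increasing) = a , injective , inRange , comparable
  where
  injective : Injective _≡_ _≡_ a
  injective {i} {j} ai≡aj with <ᶠ-cmp i j
  ... | tri< i<j _ _ = contradiction (subst (a i <[ s ]_) (sym ai≡aj) (increasing i j i<j)) (<[s]-irrefl 1≤s (a i))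
  ... | tri≈ _ i≡j _ = i≡j
  ... | tri> _ _ j<i = contradiction (subst (a j <[ s ]_) ai≡aj (increasing j i j<i)) (<[s]-irrefl 1≤s (a j))
  comparable : SComparableSet s a
  comparable i j ai≢aj with <ᶠ-cmp i j
  ... | tri< i<j _ _ = inj₁ (increasing i j i<j)
  ... | tri≈ _ i≡j _ = contradiction (cong a i≡j) ai≢aj
  ... | tri> _ _ j<i = inj₂ (increasing j i j<i)

select : (Fin r → Bool) → Vec A r → List A
select w []       = []ˡ
select w (x ∷ xs) = if w fzero then x ∷ˡ select (w ∘ fsuc) xs else select (w ∘ fsuc) xs

length-select : (w : Fin r → Bool) (xs : Vec A r) → length (select w xs) ≡ count r w
length-select w []       = refl
length-select w (x ∷ xs) with w fzero
... | true  = cong suc (length-select (w ∘ fsuc) xs)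
... | false = length-select (w ∘ fsuc) xs

All-select : {P : A → Set} (w : Fin r → Bool) (xs : Vec A r) → (∀ i → P (lookup xs i)) → All P (select w xs)
All-select w []       all = []ᵃ
All-select w (x ∷ xs) all with w fzero
... | true  = all fzero ∷ᵃ All-select (w ∘ fsuc) xs (all ∘ fsuc)
... | false = All-select (w ∘ fsuc) xs (all ∘ fsuc)

horner : ℕ → List ℕ → ℕ
horner k []ˡ       = 0
horner k (d ∷ˡ ds) = d * k ^ length ds + horner k ds

leading-digit-< : ∀ {a b h} L → a < b → h < k ^ L → a * k ^ L + h < b * k ^ L
leading-digit-< {k} {a} {b} {h} L a<b h<kᴸ = begin-strict
  a * k ^ L + h      <⟨ +-monoʳ-< (a * k ^ L) h<kᴸ ⟩
  a * k ^ L + k ^ L  ≡⟨ +-comm (a * k ^ L) _ ⟩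
  suc a * k ^ L      ≤⟨ *-monoˡ-≤ (k ^ L) a<b ⟩
  b * k ^ L          ∎
  where open ≤-Reasoning

horner-< : {ds : List ℕ} → All (_< k) ds → horner k ds < k ^ length ds
horner-< []ᵃ                          = s≤s z≤n
horner-< {ds = d ∷ˡ ds} (d<k ∷ᵃ ds<k) = leading-digit-< (length ds) d<k (horner-< ds<k)

data LexLessAt : Vec ℕ r → Vec ℕ r → Fin r → Set where
  here  : ∀ {a b} {xs ys : Vec ℕ r} → a < b → LexLessAt (a ∷ xs) (b ∷ ys) fzero
  there : ∀ {a p} {xs ys : Vec ℕ r} → LexLessAt xs ys p → LexLessAt (a ∷ xs) (a ∷ ys) (fsuc p)

horner-select-mono : (w : Fin r → Bool) {xs ys : Vec ℕ r} {p : Fin r} → LexLessAt xs ys p → w p ≡ true →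
  (∀ i → lookup xs i < k) → horner k (select w xs) < horner k (select w ys)
horner-select-mono {k = k} w {a ∷ xs} {b ∷ ys} (here a<b) w₀ digits<k with w fzero
... | true rewrite length-select (w ∘ fsuc) xs | length-select (w ∘ fsuc) ys =
  ≤-trans (leading-digit-< (count _ (w ∘ fsuc)) a<b tail<) (m≤m+n _ _)
  where
  tail< : horner k (select (w ∘ fsuc) xs) < k ^ count _ (w ∘ fsuc)
  tail< = subst (λ L → horner k (select (w ∘ fsuc) xs) < k ^ L) (length-select (w ∘ fsuc) xs)
                (horner-< (All-select (w ∘ fsuc) xs (digits<k ∘ fsuc)))
horner-select-mono w {a ∷ xs} {.a ∷ ys} (there lex) wₚ digits<k with w fzero
... | false = horner-select-mono (w ∘ fsuc) lex wₚ (digits<k ∘ fsuc)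
... | true rewrite length-select (w ∘ fsuc) xs | length-select (w ∘ fsuc) ys =
  +-monoʳ-< _ (horner-select-mono (w ∘ fsuc) lex wₚ (digits<k ∘ fsuc))

/-%-lex : ∀ {N M} d .{{_ : NonZero d}} → N < M → N / d < M / d ⊎ (N / d ≡ M / d × N % d < M % d)
/-%-lex {N} {M} d N<M with <-cmp (N / d) (M / d)
... | tri< q<q′ _ _ = inj₁ q<q′
... | tri> _ _ q>q′ = contradiction (/-monoˡ-≤ d (<⇒≤ N<M)) (<⇒≱ q>q′)
... | tri≈ _ q≡q′ _ = inj₂ (q≡q′ , +-cancelʳ-< _ (N % d) (M % d) (subst₂ _<_
  (trans (m≡m%n+[m/n]*n N d) (cong (λ q → N % d + q * d) q≡q′)) (m≡m%n+[m/n]*n M d) N<M))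

module _ (k : ℕ) .{{_ : NonZero k}} where

  digits : ∀ r → ℕ → Vec ℕ r
  digits zero    N = []
  digits (suc r) N = N / k ^ r ∷ digits r (N % k ^ r)
    where instance _ = m^n≢0 k r

  digits-< : ∀ r {N} → N < k ^ r → ∀ i → lookup (digits r N) i < k
  digits-< (suc r) {N} N<k^r fzero    = m<n*o⇒m/o<n {N} {k} {k ^ r} {{m^n≢0 k r}} N<k^r
  digits-< (suc r) {N} N<k^r (fsuc i) = digits-< r (m%n<n N (k ^ r) {{m^n≢0 k r}}) i

  digits-lex : ∀ r {N M} → N < M → M < k ^ r → ∃ (LexLessAt (digits r N) (digits r M))
  digits-lex zero    N<M M<1 = contradiction (<-≤-trans N<M (s≤s⁻¹ M<1)) λ ()
  digits-lex (suc r) {N} {M} N<M M<k^r with /-%-lex (k ^ r) {{m^n≢0 k r}} N<M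
  ... | inj₁ q<q′ = fzero , here q<q′
  ... | inj₂ (q≡q′ , N%<M%) with p , lex ← digits-lex r N%<M% (m%n<n M (k ^ r) {{m^n≢0 k r}}) rewrite q≡q′ =
    fsuc p , there lex

  module _ {r s : ℕ} .{{_ : NonZero r}} (s≤r : s ≤ r) where

    -- The digits read by coordinate j form a cyclic window of s positions; as the relation
    -- is symmetric in j and q, each digit position is read by exactly s coordinates.
    reads : Fin r → Fin r → Bool
    reads j q = does ((toℕ j + toℕ q) % r <? s)

    encode : Vec ℕ r → Tuple r
    encode xs = tabulate (λ j → suc (horner k (select (reads j) xs)))

    windowSeq : Fin (k ^ r) → Tuple r
    windowSeq i = encode (digits r (toℕ i))

    lookup-encode : ∀ xs j → lookup (encode xs) j ≡ suc (horner k (select (reads j) xs))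
    lookup-encode xs j = lookup∘tabulate _ j

    encode-< : ∀ xs → (∀ i → lookup xs i < k) → ∀ j → horner k (select (reads j) xs) < k ^ s
    encode-< xs digits<k j = subst (λ L → horner k (select (reads j) xs) < k ^ L)
      (trans (length-select (reads j) xs) (count-window r s≤r (toℕ j)))
      (horner-< (All-select (reads j) xs digits<k))

    encode-mono : {xs ys : Vec ℕ r} {p : Fin r} → LexLessAt xs ys p → (∀ i → lookup xs i < k) →
      ∀ j → reads j p ≡ true → lookup (encode xs) j < lookup (encode ys) j
    encode-mono {xs} {ys} lex digits<k j reads-p = subst₂ _<_ (sym (lookup-encode xs j)) (sym (lookup-encode ys j))
      (s≤s (horner-select-mono (reads j) lex reads-p digits<k))

    windowSeq-inRange : ∀ i → InRange (k ^ s) (windowSeq i)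
    windowSeq-inRange i j rewrite lookup-encode (digits r (toℕ i)) j =
      s≤s z≤n , encode-< (digits r (toℕ i)) (digits-< r (toℕ<n i)) j

    windowSeq-increasing : SIncreasing s windowSeq
    windowSeq-increasing i j i<j with p , lex ← digits-lex r i<j (toℕ<n j) = begin
      s                                  ≡⟨ count-window r s≤r (toℕ p) ⟨
      count r (λ c → does ((toℕ p + toℕ c) % r <? s))
        ≡⟨ count-cong r (λ c → cong (λ x → does (x % r <? s)) (+-comm (toℕ p) (toℕ c))) ⟩
      count r (λ c → reads c p)
        ≤⟨ count-mono r (λ c → dec-true (_ <? _) ∘ encode-mono lex (digits-< r (toℕ<n i)) c) ⟩
      count r (λ c → does (lookup (windowSeq i) c <? lookup (windowSeq j) c))
        ≡⟨ countLess≡count (windowSeq i) (windowSeq j) ⟨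
      countLess (windowSeq i) (windowSeq j)  ∎
      where open ≤-Reasoning

    windowSeq-incSeq : HasIncSeq r s (k ^ s) (k ^ r)
    windowSeq-incSeq = windowSeq , windowSeq-inRange , windowSeq-increasing

incSeq-empty : HasIncSeq r s n 0
incSeq-empty = (λ ()) , (λ ()) , (λ ())

perfectPower-incSeq : .{{_ : NonZero r}} → ∀ k → s ≤ r → n ≡ k ^ s → HasIncSeq r s n (k ^ r)
perfectPower-incSeq {r = suc _} zero s≤r _ = incSeq-empty
perfectPower-incSeq         (suc k) s≤r refl = windowSeq-incSeq (suc k) s≤r

∃-family? : {Q : Pred A _} → Decidable Q → (xs : List A) → (∀ {x} → Q x → x ∈ xs) →
  ∀ m {P : Pred (Fin m → A) _} → Decidable P → (∀ {f g} → (∀ i → f i ≡ g i) → P f → P g) →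
  Dec (Σ (Fin m → A) λ f → (∀ i → Q (f i)) × P f)
∃-family? Q? xs complete zero P? resp =
  map′ (λ p → Vector.[] , (λ ()) , p) (λ (f , _ , p) → resp (λ ()) p) (P? Vector.[])
∃-family? {A = A} {Q = Q} Q? xs complete (suc m) {P} P? resp = map′ extend restrict
  (any? (λ x → Q? x ×-dec ∃-family? Q? xs complete m (P? ∘ (x Vector.∷_)) (resp ∘ cons-cong x)) xs)
  where
  cons-cong : ∀ x {g g′ : Fin m → A} → (∀ i → g i ≡ g′ i) → ∀ i → (x Vector.∷ g) i ≡ (x Vector.∷ g′) i
  cons-cong x g≗g′ fzero    = refl
  cons-cong x g≗g′ (fsuc i) = g≗g′ i
  R : A → Set
  R x = Q x × Σ (Fin m → A) λ g → (∀ i → Q (g i)) × P (x Vector.∷ g)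
  extend : Any R xs → Σ (Fin (suc m) → A) λ f → (∀ i → Q (f i)) × P f
  extend found with x , qx , g , qg , p ← satisfied found = x Vector.∷ g , (λ { fzero → qx ; (fsuc i) → qg i }) , p
  restrict : Σ (Fin (suc m) → A) (λ f → (∀ i → Q (f i)) × P f) → Any R xs
  restrict (f , qf , p) = lose (complete (qf fzero))
    (qf fzero , Vector.tail f , qf ∘ fsuc , resp (λ { fzero → refl ; (fsuc i) → refl }) p)

injective? : DecidableEquality A → (f : Fin m → A) → Dec (Injective _≡_ _≡_ f)
injective? _≟ᴬ_ f = map′ (λ inj {i} {j} → inj i j) (λ inj i j → inj)
  (all? λ i → all? λ j → (f i ≟ᴬ f j) →-dec (i ≟ᶠ j))

InRange? : ∀ n (a : Tuple r) → Dec (InRange n a)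
InRange? n a = all? λ i → (1 ≤? lookup a i) ×-dec (lookup a i ≤? n)

HasIncSeq? : ∀ r s n m → Dec (HasIncSeq r s n m)
HasIncSeq? r s n m = ∃-family? (InRange? n) (tuples n r) ∈-tuples m increasing? resp
  where
  increasing? : (a : Fin m → Tuple r) → Dec (SIncreasing s a)
  increasing? a = all? λ i → all? λ j → (i <ᶠ? j) →-dec (s ≤? countLess (a i) (a j))
  resp : ∀ {a b : Fin m → Tuple r} → (∀ i → a i ≡ b i) → SIncreasing s a → SIncreasing s b
  resp a≗b increasing i j i<j = subst₂ (_<[ s ]_) (a≗b i) (a≗b j) (increasing i j i<j)

HasCompSet? : ∀ r s n m → Dec (HasCompSet r s n m)
HasCompSet? r s n m =
  map′ (λ (a , inRange , inj , comparable) → a , (λ {i} {j} → inj {i} {j}) , inRange , comparable)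
       (λ (a , inj , inRange , comparable) → a , inRange , (λ {i} {j} → inj {i} {j}) , comparable)
       (∃-family? (InRange? n) (tuples n r) ∈-tuples m injComparable? resp)
  where
  injComparable? : (a : Fin m → Tuple r) → Dec (Injective _≡_ _≡_ a × SComparableSet s a)
  injComparable? a = injective? (≡-dec _≟_) a ×-dec (all? λ i → all? λ j →
    ¬? (≡-dec _≟_ (a i) (a j)) →-dec ((s ≤? countLess (a i) (a j)) ⊎-dec (s ≤? countLess (a j) (a i))))
  resp : ∀ {a b : Fin m → Tuple r} → (∀ i → a i ≡ b i) →
    Injective _≡_ _≡_ a × SComparableSet s a → Injective _≡_ _≡_ b × SComparableSet s b
  resp {a} {b} a≗b (inj , comparable) =
    (λ {i} {j} bi≡bj → inj (trans (a≗b i) (trans bi≡bj (sym (a≗b j))))) ,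
    λ i j bi≢bj → Sum.map (subst₂ (_<[ s ]_) (a≗b i) (a≗b j)) (subst₂ (_<[ s ]_) (a≗b j) (a≗b i))
      (comparable i j (λ ai≡aj → bi≢bj (trans (sym (a≗b i)) (trans ai≡aj (a≗b j)))))

greatest : {H : ℕ → Set} → (∀ m → Dec (H m)) → ∀ B → (∀ m → H m → m ≤ B) → H 0 →
  Σ ℕ λ M → H M × (∀ m → H m → m ≤ M)
greatest H? zero    bound h₀ = 0 , h₀ , bound
greatest H? (suc B) bound h₀ with H? (suc B)
... | yes h = suc B , h , bound
... | no ¬h = greatest H? B (λ m hₘ → s≤s⁻¹ (≤∧≢⇒< (bound m hₘ) λ { refl → ¬h hₘ })) h₀

F-exists : 1 ≤ s → s ≤ r → Σ ℕ (IsF r s n)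
F-exists {s} {r} {n} 1≤s s≤r = greatest (HasIncSeq? r s n) (n ^ (r ∸ s + 1))
  (λ m → compSet-bound 1≤s s≤r ∘ incSeq⇒compSet 1≤s) incSeq-empty

G-exists : 1 ≤ s → s ≤ r → Σ ℕ (IsG r s n)
G-exists {s} {r} {n} 1≤s s≤r = greatest (HasCompSet? r s n) (n ^ (r ∸ s + 1))
  (λ m → compSet-bound 1≤s s≤r) (incSeq⇒compSet 1≤s incSeq-empty)

proposition1p12 : (r s n : ℕ) → 1 ≤ r → 1 ≤ s → 1 ≤ n → s ≤ r →
    Σ ℕ λ F → Σ ℕ λ G → IsF r s n F × IsG r s n G ×
      F ≤ G × G ≤ n ^ (r ∸ s + 1) ×
      (∀ (k : ℕ) → n ≡ k ^ s → (F ≤ G × k ^ r ≤ F))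
proposition1p12 r s n 1≤r 1≤s _ s≤r
  with F , isF@(hasF , maxF) ← F-exists {n = n} 1≤s s≤r
     | G , isG@(hasG , maxG) ← G-exists {n = n} 1≤s s≤r =
  let F≤G = maxG F (incSeq⇒compSet 1≤s hasF) in
  F , G , isF , isG , F≤G , compSet-bound 1≤s s≤r hasG ,
  λ k n≡kˢ → F≤G , maxF (k ^ r) (perfectPower-incSeq {{>-nonZero 1≤r}} k s≤r n≡kˢ)
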